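{- Let $L$ be a Lie ring, $A$ a subring of $L$ and $H$ an ideal of $A$. Then for every $n\ge 0$, the iterated centralizer $C_L^n(A/H)$ is a subring of $L$. Moreover, if $I$ is an ideal of $L$, then for every $n$, $C_L^n(I)$ is an ideal of $L$ and $C_L^n(I)=\{x\in L : [I,_n x]=0\}$.
   Context: A Lie ring is an abelian group with a bi-additive bracket satisfying $[x,x]=0$ and the Jacobi identity. For $X\subseteq L$, $N_L(X)=\{x\in L:[x,X]\subseteq X\}$. Iterated centralizers: $C_L^0(A/H)=H$ and $C_L^{n+1}(A/H)=\{x\in \bigcap_{0\le i\le n}N_L(C_L^i(A/H)) : [x,A]\subseteq C_L^n(A/H)\}$; $C_L^n(A)$ denotes $C_L^n(A/\{0\})$. For an additive subgroup $A$ and $x\in L$, $[A,_n x]$ is the additive subgroup generated by the elements $\operatorname{ad}_{a_1}\circ\cdots\circ\operatorname{ad}_{a_n}(x)$ with $a_1,\dots,a_n\in A$, where $\operatorname{ad}_a(y)=[a,y]$. -}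

module Defs where

open import Level using (Level; suc; _⊔_)
open import Algebra.Core using (Op₁; Op₂)
open import Algebra.Structures using (IsAbelianGroup)
open import Data.Nat using (ℕ; zero) renaming (suc to sucℕ)
open import Data.Product using (_×_; ∃-syntax)
open import Data.Vec using (Vec; []; _∷_)
open import Data.Vec.Relation.Unary.All using (All)
open import Relation.Unary using (Pred; _⊆_)
open import Relation.Binary.PropositionalEquality using (_≡_)

record LieRing (c : Level) : Set (suc c) where
  infixl 6 _+_
  field
    Carrier        : Set c
    _+_            : Op₂ Carrier
    0#             : Carrier
    -_             : Op₁ Carrier
    [_,_]          : Op₂ Carrier
    isAbelianGroup : IsAbelianGroup _≡_ _+_ 0# -_
    bracket-addˡ   : ∀ x y z → [ x + y , z ] ≡ [ x , z ] + [ y , z ]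
    bracket-addʳ   : ∀ x y z → [ x , y + z ] ≡ [ x , y ] + [ x , z ]
    alternating    : ∀ x → [ x , x ] ≡ 0#
    jacobi         : ∀ x y z →
                     [ x , [ y , z ] ] + [ y , [ z , x ] ] + [ z , [ x , y ] ] ≡ 0#

module _ {c : Level} (L : LieRing c) where
  open LieRing L

  record IsAddSubgroup (S : Pred Carrier c) : Set c where
    field
      0∈  : S 0#
      +∈  : ∀ {x y} → S x → S y → S (x + y)
      -∈  : ∀ {x} → S x → S (- x)

  record IsSubring (S : Pred Carrier c) : Set c where
    field
      addSubgroup : IsAddSubgroup S
      []∈         : ∀ {x y} → S x → S y → S [ x , y ]

  record IsIdealOf (A H : Pred Carrier c) : Set c where
    field
      H⊆A         : H ⊆ A
      addSubgroup : IsAddSubgroup H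
      absorb      : ∀ {a h} → A a → H h → H [ a , h ]

  record IsIdeal (I : Pred Carrier c) : Set c where
    field
      addSubgroup : IsAddSubgroup I
      absorb      : ∀ {x y} → I y → I [ x , y ]

  N : Pred Carrier c → Pred Carrier c
  N X x = ∀ {y} → X y → X [ x , y ]

  -- iterated centralizers C^n(A/H), together with the predicate
  -- NormUpTo n x  ≡  x ∈ ⋂_{0 ≤ i ≤ n} N_L(C^i(A/H))
  module _ (A H : Pred Carrier c) where
    mutual
      C : ℕ → Pred Carrier c
      C zero       = H
      C (sucℕ n) x = NormUpTo n x × (∀ {a} → A a → C n [ x , a ])

      NormUpTo : ℕ → Pred Carrier c
      NormUpTo zero     x = N (C zero) x
      NormUpTo (sucℕ n) x = NormUpTo n x × N (C (sucℕ n)) x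

  Zero : Pred Carrier c
  Zero x = x ≡ 0#

  C₀ : Pred Carrier c → ℕ → Pred Carrier c
  C₀ A = C A Zero

  data Gen (S : Pred Carrier c) : Pred Carrier c where
    gen  : ∀ {x} → S x → Gen S x
    zero : Gen S 0#
    add  : ∀ {x y} → Gen S x → Gen S y → Gen S (x + y)
    neg  : ∀ {x} → Gen S x → Gen S (- x)

  iterAd : ∀ {n} → Vec Carrier n → Carrier → Carrier
  iterAd []       x = x
  iterAd (a ∷ as) x = [ a , iterAd as x ]

  IterBr : Pred Carrier c → ℕ → Carrier → Pred Carrier c
  IterBr A n x = Gen (λ y → ∃[ as ] (All A {n} as × y ≡ iterAd as x))

-- Both parts rest on the Leibniz form of the Jacobi identity,
-- [[x,y],a] = [x,[y,a]] + [y,[a,x]]: if x and y normalise an additive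
-- subgroup X and [x,a], [y,a] ∈ X, then [[x,y],a] ∈ X. By induction on n this
-- makes the intersection of the normalisers of C⁰,…,Cⁿ a subring, and then
-- Cⁿ⁺¹ a subring. When I is an ideal of L every Cⁿ(I) is an ideal, so the
-- normaliser condition in the definition of Cⁿ⁺¹(I) holds automatically and
-- x ∈ Cⁿ⁺¹(I) iff [a,x] ∈ Cⁿ(I) for all a ∈ I; iterating n times gives
-- x ∈ Cⁿ(I) iff [a₁,[a₂,…[aₙ,x]…]] = 0 for all a₁,…,aₙ ∈ I.
module Submission where

open import Defs
open import Level using (Level)
open import Algebra.Bundles using (AbelianGroup)
import Algebra.Properties.Group as GroupProperties
open import Data.Nat using (ℕ; zero; suc) renaming (_+_ to _+ℕ_)
open import Data.Nat.Properties using (+-suc; +-identityʳ)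
open import Data.Product using (_×_; _,_; proj₁; proj₂)
open import Data.Vec using (Vec; []; _∷_)
open import Data.Vec.Relation.Unary.All using (All; []; _∷_)
open import Function.Bundles using (_⇔_; mk⇔)
open import Relation.Unary using (Pred; _⊆_; _∩_)
open import Relation.Binary.PropositionalEquality
  using (_≡_; refl; sym; trans; cong; cong₂; subst; module ≡-Reasoning)

module LieRingProperties {c : Level} (L : LieRing c) where
  open LieRing L

  private
    additiveGroup : AbelianGroup c c
    additiveGroup = record { isAbelianGroup = isAbelianGroup }

    open AbelianGroup additiveGroup using (group; identityˡ; identityʳ; inverseʳ)
    open GroupProperties group
      using (identityˡ-unique; inverseʳ-unique; ⁻¹-involutive; ε⁻¹≈ε)

  bracket-zeroˡ : ∀ x → [ 0# , x ] ≡ 0#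
  bracket-zeroˡ x = identityˡ-unique _ _
    (trans (sym (bracket-addˡ 0# 0# x)) (cong [_, x ] (identityˡ 0#)))

  bracket-zeroʳ : ∀ x → [ x , 0# ] ≡ 0#
  bracket-zeroʳ x = identityˡ-unique _ _
    (trans (sym (bracket-addʳ x 0# 0#)) (cong [ x ,_] (identityˡ 0#)))

  bracket-negˡ : ∀ x y → [ - x , y ] ≡ - [ x , y ]
  bracket-negˡ x y = inverseʳ-unique _ _
    (trans (sym (bracket-addˡ x (- x) y))
           (trans (cong [_, y ] (inverseʳ x)) (bracket-zeroˡ y)))

  bracket-antisym : ∀ x y → [ y , x ] ≡ - [ x , y ]
  bracket-antisym x y = inverseʳ-unique _ _ (begin
    [ x , y ] + [ y , x ]
      ≡⟨ sym (cong₂ _+_ (identityˡ [ x , y ]) (identityʳ [ y , x ])) ⟩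
    0# + [ x , y ] + ([ y , x ] + 0#)
      ≡⟨ sym (cong₂ (λ u v → u + [ x , y ] + ([ y , x ] + v)) (alternating x) (alternating y)) ⟩
    [ x , x ] + [ x , y ] + ([ y , x ] + [ y , y ])
      ≡⟨ sym (cong₂ _+_ (bracket-addʳ x x y) (bracket-addʳ y x y)) ⟩
    [ x , x + y ] + [ y , x + y ]
      ≡⟨ sym (bracket-addˡ x y (x + y)) ⟩
    [ x + y , x + y ]
      ≡⟨ alternating (x + y) ⟩
    0# ∎)
    where open ≡-Reasoning

  bracket-leibniz : ∀ x y z → [ [ x , y ] , z ] ≡ [ x , [ y , z ] ] + [ y , [ z , x ] ]
  bracket-leibniz x y z = begin
    [ [ x , y ] , z ]                             ≡⟨ bracket-antisym z [ x , y ] ⟩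
    - [ z , [ x , y ] ]                           ≡⟨ cong -_ (inverseʳ-unique _ _ (jacobi x y z)) ⟩
    - (- ([ x , [ y , z ] ] + [ y , [ z , x ] ])) ≡⟨ ⁻¹-involutive _ ⟩
    [ x , [ y , z ] ] + [ y , [ z , x ] ]         ∎
    where open ≡-Reasoning

  Zero-isIdeal : IsIdeal L (Zero L)
  Zero-isIdeal = record
    { addSubgroup = record
      { 0∈ = refl
      ; +∈ = λ x≡0 y≡0 → trans (cong₂ _+_ x≡0 y≡0) (identityʳ 0#)
      ; -∈ = λ x≡0 → trans (cong -_ x≡0) ε⁻¹≈ε
      }
    ; absorb = λ {x} y≡0 → trans (cong [ x ,_] y≡0) (bracket-zeroʳ x)
    }

  Gen-minimal : ∀ {S X} → IsAddSubgroup L X → S ⊆ X → Gen L S ⊆ X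
  Gen-minimal X-sub S⊆X (gen s)   = S⊆X s
  Gen-minimal X-sub S⊆X zero      = IsAddSubgroup.0∈ X-sub
  Gen-minimal X-sub S⊆X (add g h) = IsAddSubgroup.+∈ X-sub (Gen-minimal X-sub S⊆X g) (Gen-minimal X-sub S⊆X h)
  Gen-minimal X-sub S⊆X (neg g)   = IsAddSubgroup.-∈ X-sub (Gen-minimal X-sub S⊆X g)

  ∩-isSubring : ∀ {X Y} → IsSubring L X → IsSubring L Y → IsSubring L (X ∩ Y)
  ∩-isSubring X-ring Y-ring = record
    { addSubgroup = record
      { 0∈ = X.0∈ , Y.0∈
      ; +∈ = λ x∈ y∈ → X.+∈ (proj₁ x∈) (proj₁ y∈) , Y.+∈ (proj₂ x∈) (proj₂ y∈)
      ; -∈ = λ x∈ → X.-∈ (proj₁ x∈) , Y.-∈ (proj₂ x∈)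
      }
    ; []∈ = λ x∈ y∈ → IsSubring.[]∈ X-ring (proj₁ x∈) (proj₁ y∈) , IsSubring.[]∈ Y-ring (proj₂ x∈) (proj₂ y∈)
    }
    where
    module X = IsAddSubgroup (IsSubring.addSubgroup X-ring)
    module Y = IsAddSubgroup (IsSubring.addSubgroup Y-ring)

  module _ {X : Pred Carrier c} (X-sub : IsAddSubgroup L X) where
    open IsAddSubgroup X-sub

    bracket-flip-∈ : ∀ {x y} → X [ x , y ] → X [ y , x ]
    bracket-flip-∈ {x} {y} xy∈X = subst X (sym (bracket-antisym x y)) (-∈ xy∈X)

    bracket-leibniz-∈ : ∀ {x y z} → X [ x , [ y , z ] ] → X [ y , [ z , x ] ] → X [ [ x , y ] , z ]
    bracket-leibniz-∈ {x} {y} {z} p q = subst X (sym (bracket-leibniz x y z)) (+∈ p q)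

    N-isSubring : IsSubring L (N L X)
    N-isSubring = record
      { addSubgroup = record
        { 0∈ = λ {y} _ → subst X (sym (bracket-zeroˡ y)) 0∈
        ; +∈ = λ {x} {x′} nx nx′ {y} y∈X → subst X (sym (bracket-addˡ x x′ y)) (+∈ (nx y∈X) (nx′ y∈X))
        ; -∈ = λ {x} nx {y} y∈X → subst X (sym (bracket-negˡ x y)) (-∈ (nx y∈X))
        }
      ; []∈ = λ nx ny y∈X → bracket-leibniz-∈ (nx (ny y∈X)) (ny (bracket-flip-∈ (nx y∈X)))
      }

  module IteratedCentralizer (A H : Pred Carrier c) (H-sub : IsAddSubgroup L H) where
    Cⁿ : ℕ → Pred Carrier c
    Cⁿ = C L A H

    NormUpTo⇒N : ∀ n {x} → NormUpTo L A H n x → N L (Cⁿ n) x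
    NormUpTo⇒N zero    nx        = nx
    NormUpTo⇒N (suc n) (_ , nx) = nx

    C-isAddSubgroup    : ∀ n → IsAddSubgroup L (Cⁿ n)
    NormUpTo-isSubring : ∀ n → IsSubring L (NormUpTo L A H n)

    C-isAddSubgroup zero    = H-sub
    C-isAddSubgroup (suc n) = record
      { 0∈ = Norm.0∈ , λ {a} _ → subst (Cⁿ n) (sym (bracket-zeroˡ a)) Cₙ.0∈
      ; +∈ = λ {x} {y} x∈C y∈C → Norm.+∈ (proj₁ x∈C) (proj₁ y∈C) , λ {a} a∈A →
               subst (Cⁿ n) (sym (bracket-addˡ x y a)) (Cₙ.+∈ (proj₂ x∈C a∈A) (proj₂ y∈C a∈A))
      ; -∈ = λ {x} x∈C → Norm.-∈ (proj₁ x∈C) , λ {a} a∈A →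
               subst (Cⁿ n) (sym (bracket-negˡ x a)) (Cₙ.-∈ (proj₂ x∈C a∈A))
      }
      where
      module Norm = IsAddSubgroup (IsSubring.addSubgroup (NormUpTo-isSubring n))
      module Cₙ   = IsAddSubgroup (C-isAddSubgroup n)

    NormUpTo-isSubring zero    = N-isSubring (C-isAddSubgroup zero)
    NormUpTo-isSubring (suc n) = ∩-isSubring (NormUpTo-isSubring n) (N-isSubring (C-isAddSubgroup (suc n)))

    C-suc-isSubring : ∀ n → IsSubring L (Cⁿ (suc n))
    C-suc-isSubring n = record
      { addSubgroup = C-isAddSubgroup (suc n)
      ; []∈ = λ (nx , cx) (ny , cy) →
          IsSubring.[]∈ (NormUpTo-isSubring n) nx ny ,
          λ a∈A → bracket-leibniz-∈ (C-isAddSubgroup n)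
                    (NormUpTo⇒N n nx (cy a∈A))
                    (NormUpTo⇒N n ny (bracket-flip-∈ (C-isAddSubgroup n) (cx a∈A)))
      }

  C-isSubring : ∀ {A H} → IsIdealOf L A H → ∀ n → IsSubring L (C L A H n)
  C-isSubring H-ideal zero = record
    { addSubgroup = IsIdealOf.addSubgroup H-ideal
    ; []∈ = λ x∈H y∈H → IsIdealOf.absorb H-ideal (IsIdealOf.H⊆A H-ideal x∈H) y∈H
    }
  C-isSubring {A} {H} H-ideal (suc n) =
    IteratedCentralizer.C-suc-isSubring A H (IsIdealOf.addSubgroup H-ideal) n

  module CentralizerOfIdeal {I : Pred Carrier c} (I-ideal : IsIdeal L I) where
    open IteratedCentralizer I (Zero L) (IsIdeal.addSubgroup Zero-isIdeal)

    C₀-isIdeal         : ∀ n → IsIdeal L (Cⁿ n)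
    NormUpTo-universal : ∀ n x → NormUpTo L I (Zero L) n x

    C₀-isIdeal zero    = Zero-isIdeal
    C₀-isIdeal (suc n) = record
      { addSubgroup = C-isAddSubgroup (suc n)
      ; absorb = λ y∈C → NormUpTo-universal n _ , λ a∈I →
          bracket-leibniz-∈ (C-isAddSubgroup n)
            (IsIdeal.absorb (C₀-isIdeal n) (proj₂ y∈C a∈I))
            (proj₂ y∈C (bracket-flip-∈ (IsIdeal.addSubgroup I-ideal) (IsIdeal.absorb I-ideal a∈I)))
      }

    NormUpTo-universal zero    x = IsIdeal.absorb (C₀-isIdeal zero)
    NormUpTo-universal (suc n) x = NormUpTo-universal n x , IsIdeal.absorb (C₀-isIdeal (suc n))

    C₀-suc⁻ : ∀ k {a z} → Cⁿ (suc k) z → I a → Cⁿ k [ a , z ]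
    C₀-suc⁻ k (_ , cz) a∈I = bracket-flip-∈ (C-isAddSubgroup k) (cz a∈I)

    C₀-suc⁺ : ∀ k {z} → (∀ {a} → I a → Cⁿ k [ a , z ]) → Cⁿ (suc k) z
    C₀-suc⁺ k {z} az∈Cₖ = NormUpTo-universal k z , λ a∈I → bracket-flip-∈ (C-isAddSubgroup k) (az∈Cₖ a∈I)

    C₀-iterAd⁻ : ∀ m k {as : Vec Carrier m} {y} → All I as → Cⁿ (m +ℕ k) y → Cⁿ k (iterAd L as y)
    C₀-iterAd⁻ zero    k []           y∈C = y∈C
    C₀-iterAd⁻ (suc m) k {y = y} (a∈I ∷ as∈I) y∈C =
      C₀-suc⁻ k (C₀-iterAd⁻ m (suc k) as∈I (subst (λ j → Cⁿ j y) (sym (+-suc m k)) y∈C)) a∈I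

    C₀-iterAd⁺ : ∀ m k {y} → (∀ {as : Vec Carrier m} → All I as → Cⁿ k (iterAd L as y)) → Cⁿ (m +ℕ k) y
    C₀-iterAd⁺ zero    k h = h []
    C₀-iterAd⁺ (suc m) k {y} h = subst (λ j → Cⁿ j y) (+-suc m k)
      (C₀-iterAd⁺ m (suc k) λ as∈I → C₀-suc⁺ k λ a∈I → h (a∈I ∷ as∈I))

    C₀-iff-IterBr-zero : ∀ n x → Cⁿ n x ⇔ (∀ y → IterBr L I n x y → y ≡ 0#)
    C₀-iff-IterBr-zero n x = mk⇔ C₀⇒IterBr-zero IterBr-zero⇒C₀
      where
      Cₙ₊₀≡Cₙ : Cⁿ (n +ℕ 0) ≡ Cⁿ n
      Cₙ₊₀≡Cₙ = cong Cⁿ (+-identityʳ n)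

      C₀⇒IterBr-zero : Cⁿ n x → ∀ y → IterBr L I n x y → y ≡ 0#
      C₀⇒IterBr-zero x∈C _ = Gen-minimal (IsIdeal.addSubgroup Zero-isIdeal) λ (as , as∈I , y≡iterAd) →
        trans y≡iterAd (C₀-iterAd⁻ n 0 as∈I (subst (λ X → X x) (sym Cₙ₊₀≡Cₙ) x∈C))

      IterBr-zero⇒C₀ : (∀ y → IterBr L I n x y → y ≡ 0#) → Cⁿ n x
      IterBr-zero⇒C₀ h = subst (λ X → X x) Cₙ₊₀≡Cₙ
        (C₀-iterAd⁺ n 0 λ {as} as∈I → h _ (gen (as , as∈I , refl)))

open LieRingProperties

mainTheorem3 : {c : Level} (L : LieRing c) →
    (∀ (A H : Pred (LieRing.Carrier L) c) → IsSubring L A → IsIdealOf L A H →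
    ∀ (n : ℕ) → IsSubring L (C L A H n))
    × (∀ (I : Pred (LieRing.Carrier L) c) → IsIdeal L I → ∀ (n : ℕ) →
    IsIdeal L (C₀ L I n)
    × (∀ x → C₀ L I n x ⇔ (∀ y → IterBr L I n x y → y ≡ LieRing.0# L)))
mainTheorem3 L =
  (λ A H _ H-ideal → C-isSubring L H-ideal) ,
  λ I I-ideal n → C₀-isIdeal I-ideal n , C₀-iff-IterBr-zero I-ideal n
  where open CentralizerOfIdeal L
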